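{- If $\mathcal{C}$ is a cartesian closed category with equalisers, then there is a bijective correspondence between $\lambda_{\mathrm{eff}}$-models on $\mathcal{C}$ and the following data: a family of strong monads $\{T_S\}_S$ on $\mathcal{C}$ indexed by semantic signatures; for each $S$ and $(\mathtt{op}:A_{\mathtt{op}}\to B_{\mathtt{op}})\in S$ a morphism $[\![\mathtt{op}]\!]_S:A_{\mathtt{op}}\to T_SB_{\mathtt{op}}$; and for each $S,S'$ and object $X$ a morphism $h_{S,S',X}:\mathcal{H}_S(X)\to\mathrm{EM}(T_S;T_{S'}X)$ such that $\pi_{\mathtt{op}} = (a_{\mathtt{op}}\Rightarrow T_{S'}X)\circ e\circ h$ for each $(\mathtt{op}:A_{\mathtt{op}}\to B_{\mathtt{op}})\in S$, where $(a_{\mathtt{op}}\Rightarrow T_{S'}X)$ is precomposition with $a_{\mathtt{op}}$ on internal homs.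
   Context: A semantic signature $S$ in $\mathcal{C}$ is a finite partial map from operation symbols to pairs of objects; $(\mathtt{op}:A\to B)\in S$ means $S(\mathtt{op})=(A,B)$ (this arrow is notation for an operation signature). For a strong monad $T$ with Kleisli exponentials $(Y\Rightarrow_TZ)$ (in a CCC, $(Y\Rightarrow_TZ)$ is the exponential $(TZ)^Y$) and evaluation $\mathrm{ev}$, $\mathcal{H}_S(X)=\prod_{(\mathtt{op}:A_{\mathtt{op}}\to B_{\mathtt{op}})\in S}((A_{\mathtt{op}}\times(B_{\mathtt{op}}\Rightarrow_{T_{S'}}X))\Rightarrow_{T_{S'}}X)$ with projections $\pi_{\mathtt{op}}$, and $a_{\mathtt{op}}=T_S\mathrm{ev}\circ\mathrm{st}^{T_S}\circ\mathrm{swap}\circ([\![\mathtt{op}]\!]_S\times\mathrm{id}):A_{\mathtt{op}}\times(B_{\mathtt{op}}\Rightarrow_{T_{S'}}X)\to T_ST_{S'}X$. For a strong monad $T$ and object $Y$, $e:\mathrm{EM}(T;Y)\to(TY\Rightarrow Y)$ (internal hom) is the joint equaliser of the pair $(\eta\Rightarrow Y)$ and $i_Y\circ{!}$ into $(Y\Rightarrow Y)$ and of the pair $(\mu\Rightarrow Y)$ and $m\circ\langle\mathrm{id},\lfloor T\rfloor\rangle$ into $(T^2Y\Rightarrow Y)$, where $i$, $m$ are internal identity and composition and $\lfloor T\rfloor:(X\Rightarrow Y)\to(TX\Rightarrow TY)$ is the internal action of $T$; intuitively the object of Eilenberg–Moore $T$-algebra structures on $Y$. A $\lambda_{\mathrm{eff}}$-model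 consists of a cartesian category $\mathcal{C}$ with strong monads $T_S$, Kleisli exponentials, morphisms $[\![\mathtt{op}]\!]_S$, and morphisms $\mathrm{handle}_{S,S',X}:\mathcal{H}_S(X)\times T_ST_{S'}X\to T_{S'}X$ satisfying $\mathrm{handle}\circ(\mathrm{id}\times\eta)=\pi_2$, $\mathrm{handle}\circ(\mathrm{id}\times\mu)=\mathrm{handle}\circ(\mathrm{id}\times T_S\mathrm{handle})\circ\langle\pi_1,\mathrm{st}\rangle$, and $\mathrm{handle}\circ(\mathrm{id}\times a_{\mathtt{op}})=\mathrm{ev}\circ(\pi_{\mathtt{op}}\times\mathrm{id})$. -}

module Defs where

open import Level using (Level; _⊔_) renaming (suc to lsuc; zero to lzero)
open import Data.Product using (Σ; _,_; proj₁; proj₂) renaming (_×_ to _×ᵗ_)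
open import Data.List using (List; []; _∷_; map)
open import Data.List.Membership.Propositional using (_∈_)
open import Data.List.Relation.Unary.Any using (here; there)
open import Data.List.Relation.Unary.Unique.Propositional using (Unique)
open import Relation.Binary using (IsEquivalence; Setoid)
open import Relation.Binary.PropositionalEquality using (_≡_; refl)

record Category (o ℓ e : Level) : Set (lsuc (o ⊔ ℓ ⊔ e)) where
  infix  4 _≈_ _⇒_
  infixr 9 _∘_
  field
    Obj       : Set o
    _⇒_       : Obj → Obj → Set ℓ
    _≈_       : ∀ {A B} → A ⇒ B → A ⇒ B → Set e
    ≈-equiv   : ∀ {A B} → IsEquivalence (_≈_ {A} {B})
    id        : ∀ {A} → A ⇒ A
    _∘_       : ∀ {A B C} → B ⇒ C → A ⇒ B → A ⇒ C
    assoc     : ∀ {A B C D} {f : A ⇒ B} {g : B ⇒ C} {h : C ⇒ D} →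
                (h ∘ g) ∘ f ≈ h ∘ (g ∘ f)
    identityˡ : ∀ {A B} {f : A ⇒ B} → id ∘ f ≈ f
    identityʳ : ∀ {A B} {f : A ⇒ B} → f ∘ id ≈ f
    ∘-resp-≈  : ∀ {A B C} {f h : B ⇒ C} {g i : A ⇒ B} →
                f ≈ h → g ≈ i → f ∘ g ≈ h ∘ i

record CCCWithEqualisers {o ℓ e : Level} (C : Category o ℓ e) : Set (o ⊔ ℓ ⊔ e) where
  open Category C
  infixr 7 _×_
  infixr 5 _⇨_
  field
    ⊤        : Obj
    !        : ∀ {A} → A ⇒ ⊤
    !-unique : ∀ {A} (f : A ⇒ ⊤) → f ≈ !
    _×_       : Obj → Obj → Obj
    π₁        : ∀ {A B} → A × B ⇒ A
    π₂        : ∀ {A B} → A × B ⇒ B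
    ⟨_,_⟩     : ∀ {X A B} → X ⇒ A → X ⇒ B → X ⇒ A × B
    project₁  : ∀ {X A B} {f : X ⇒ A} {g : X ⇒ B} → π₁ ∘ ⟨ f , g ⟩ ≈ f
    project₂  : ∀ {X A B} {f : X ⇒ A} {g : X ⇒ B} → π₂ ∘ ⟨ f , g ⟩ ≈ g
    ⟨⟩-unique : ∀ {X A B} {h : X ⇒ A × B} {f : X ⇒ A} {g : X ⇒ B} →
                π₁ ∘ h ≈ f → π₂ ∘ h ≈ g → ⟨ f , g ⟩ ≈ h
    _⇨_      : Obj → Obj → Obj
    eval     : ∀ {A B} → (A ⇨ B) × A ⇒ B
    curry    : ∀ {X A B} → X × A ⇒ B → X ⇒ (A ⇨ B)
    β        : ∀ {X A B} {f : X × A ⇒ B} → eval ∘ ⟨ curry f ∘ π₁ , π₂ ⟩ ≈ f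
    curry-unique : ∀ {X A B} {f : X × A ⇒ B} {g : X ⇒ (A ⇨ B)} →
                   eval ∘ ⟨ g ∘ π₁ , π₂ ⟩ ≈ f → g ≈ curry f
    Eq             : ∀ {A B} (f g : A ⇒ B) → Obj
    equalise       : ∀ {A B} (f g : A ⇒ B) → Eq f g ⇒ A
    equality       : ∀ {A B} {f g : A ⇒ B} → f ∘ equalise f g ≈ g ∘ equalise f g
    factor         : ∀ {X A B} {f g : A ⇒ B} (h : X ⇒ A) → f ∘ h ≈ g ∘ h → X ⇒ Eq f g
    factor-commute : ∀ {X A B} {f g : A ⇒ B} {h : X ⇒ A} {eq : f ∘ h ≈ g ∘ h} →
                     equalise f g ∘ factor h eq ≈ h
    factor-unique  : ∀ {X A B} {f g : A ⇒ B} {h : X ⇒ A} {eq : f ∘ h ≈ g ∘ h}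
                     (i : X ⇒ Eq f g) → equalise f g ∘ i ≈ h → i ≈ factor h eq

module Theory {o ℓ e : Level} (C : Category o ℓ e) (cc : CCCWithEqualisers C) (Op : Set) where
  open Category C
  open CCCWithEqualisers cc

  infixr 7 _×₁_
  _×₁_ : ∀ {A B A' B'} → A ⇒ A' → B ⇒ B' → A × B ⇒ A' × B'
  f ×₁ g = ⟨ f ∘ π₁ , g ∘ π₂ ⟩

  swap : ∀ {A B} → A × B ⇒ B × A
  swap = ⟨ π₂ , π₁ ⟩

  assocʳ : ∀ {A B D} → (A × B) × D ⇒ A × (B × D)
  assocʳ = ⟨ π₁ ∘ π₁ , ⟨ π₂ ∘ π₁ , π₂ ⟩ ⟩

  record StrongMonad : Set (o ⊔ ℓ ⊔ e) where
    field
      F₀     : Obj → Obj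
      F₁     : ∀ {A B} → A ⇒ B → F₀ A ⇒ F₀ B
      F-id   : ∀ {A} → F₁ (id {A}) ≈ id
      F-∘    : ∀ {A B D} {f : A ⇒ B} {g : B ⇒ D} → F₁ (g ∘ f) ≈ F₁ g ∘ F₁ f
      F-resp : ∀ {A B} {f g : A ⇒ B} → f ≈ g → F₁ f ≈ F₁ g
      η      : ∀ {A} → A ⇒ F₀ A
      μ      : ∀ {A} → F₀ (F₀ A) ⇒ F₀ A
      η-nat  : ∀ {A B} {f : A ⇒ B} → F₁ f ∘ η ≈ η ∘ f
      μ-nat  : ∀ {A B} {f : A ⇒ B} → F₁ f ∘ μ ≈ μ ∘ F₁ (F₁ f)
      μ-assoc     : ∀ {A} → μ {A} ∘ F₁ μ ≈ μ ∘ μ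
      μ-identityˡ : ∀ {A} → μ {A} ∘ F₁ η ≈ id
      μ-identityʳ : ∀ {A} → μ {A} ∘ η ≈ id
      st     : ∀ {A B} → A × F₀ B ⇒ F₀ (A × B)
      st-nat : ∀ {A A' B B'} {f : A ⇒ A'} {g : B ⇒ B'} →
               st ∘ (f ×₁ F₁ g) ≈ F₁ (f ×₁ g) ∘ st
      st-unit  : ∀ {B} → F₁ π₂ ∘ st {⊤} {B} ≈ π₂
      st-assoc : ∀ {A B D} → F₁ (assocʳ {A} {B} {D}) ∘ st ≈ st ∘ (id ×₁ st) ∘ assocʳ
      st-η     : ∀ {A B} → st {A} {B} ∘ (id ×₁ η) ≈ η
      st-μ     : ∀ {A B} → st {A} {B} ∘ (id ×₁ μ) ≈ μ ∘ F₁ st ∘ st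

  open StrongMonad

  infixr 5 _⇒[_]_
  _⇒[_]_ : Obj → StrongMonad → Obj → Obj
  Y ⇒[ T ] Z = Y ⇨ F₀ T Z

  -- (f ⇒ Y) : precomposition with f on internal homs
  pre : ∀ {A B} (f : A ⇒ B) (Y : Obj) → (B ⇨ Y) ⇒ (A ⇨ Y)
  pre f Y = curry (eval ∘ (id ×₁ f))

  iid : (Y : Obj) → ⊤ ⇒ (Y ⇨ Y)
  iid Y = curry π₂

  icomp : ∀ {X Y Z} → (Y ⇨ Z) × (X ⇨ Y) ⇒ (X ⇨ Z)
  icomp = curry (eval ∘ ⟨ π₁ ∘ π₁ , eval ∘ ⟨ π₂ ∘ π₁ , π₂ ⟩ ⟩)

  ⌊_⌋ : (T : StrongMonad) → ∀ {X Y} → (X ⇨ Y) ⇒ (F₀ T X ⇨ F₀ T Y)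
  ⌊ T ⌋ = curry (F₁ T eval ∘ st T)

  -- EM(T;Y): joint equaliser of  (η ⇒ Y), i_Y ∘ !  and  (μ ⇒ Y), m ∘ ⟨id, ⌊T⌋⟩,
  -- realised as the equaliser of the two induced maps into the product.
  EM-left : (T : StrongMonad) (Y : Obj) →
            (F₀ T Y ⇨ Y) ⇒ (Y ⇨ Y) × (F₀ T (F₀ T Y) ⇨ Y)
  EM-left T Y = ⟨ pre (η T) Y , pre (μ T) Y ⟩

  EM-right : (T : StrongMonad) (Y : Obj) →
             (F₀ T Y ⇨ Y) ⇒ (Y ⇨ Y) × (F₀ T (F₀ T Y) ⇨ Y)
  EM-right T Y = ⟨ iid Y ∘ ! , icomp ∘ ⟨ id , ⌊ T ⌋ ⟩ ⟩

  EM : (T : StrongMonad) (Y : Obj) → Obj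
  EM T Y = Eq (EM-left T Y) (EM-right T Y)

  eEM : (T : StrongMonad) (Y : Obj) → EM T Y ⇒ (F₀ T Y ⇨ Y)
  eEM T Y = equalise (EM-left T Y) (EM-right T Y)

  -- Semantic signatures: finite partial maps Op ⇀ Obj × Obj, represented
  -- as lists of entries (op , A , B) with pairwise distinct operation symbols.

  Entry : Set o
  Entry = Op ×ᵗ (Obj ×ᵗ Obj)

  Sig : Set o
  Sig = Σ (List Entry) (λ l → Unique (map proj₁ l))

  _∈ˢ_ : Entry → Sig → Set o
  x ∈ˢ S = x ∈ proj₁ S

  Interp : (Sig → StrongMonad) → Set (o ⊔ ℓ)
  Interp T = ∀ (S : Sig) {op : Op} {A B : Obj} → (op , A , B) ∈ˢ S → A ⇒ F₀ (T S) B

  Hlist : List Entry → StrongMonad → Obj → Obj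
  Hlist []                  T' X = ⊤
  Hlist ((op , A , B) ∷ l)  T' X = ((A × (B ⇒[ T' ] X)) ⇒[ T' ] X) × Hlist l T' X

  πlist : ∀ {l : List Entry} {op A B} (T' : StrongMonad) (X : Obj) →
          (op , A , B) ∈ l → Hlist l T' X ⇒ ((A × (B ⇒[ T' ] X)) ⇒[ T' ] X)
  πlist T' X (here refl) = π₁
  πlist T' X (there p)   = πlist T' X p ∘ π₂

  module _ (T : Sig → StrongMonad) (ops : Interp T) where

    H : Sig → Sig → Obj → Obj
    H S S' X = Hlist (proj₁ S) (T S') X

    πop : ∀ (S S' : Sig) (X : Obj) {op A B} (p : (op , A , B) ∈ˢ S) →
          H S S' X ⇒ ((A × (B ⇒[ T S' ] X)) ⇒[ T S' ] X)
    πop S S' X p = πlist (T S') X p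

    aop : ∀ (S S' : Sig) (X : Obj) {op A B} (p : (op , A , B) ∈ˢ S) →
          A × (B ⇒[ T S' ] X) ⇒ F₀ (T S) (F₀ (T S') X)
    aop S S' X p = F₁ (T S) eval ∘ st (T S) ∘ swap ∘ (ops S p ×₁ id)

    -- λ_eff-models with the given monads and operation interpretations:
    -- handle morphisms satisfying the three laws.

    record Handlers : Set (o ⊔ ℓ ⊔ e) where
      field
        handle : ∀ (S S' : Sig) (X : Obj) →
                 H S S' X × F₀ (T S) (F₀ (T S') X) ⇒ F₀ (T S') X
        handle-η  : ∀ S S' X → handle S S' X ∘ (id ×₁ η (T S)) ≈ π₂
        handle-μ  : ∀ S S' X →
                    handle S S' X ∘ (id ×₁ μ (T S))
                      ≈ handle S S' X ∘ (id ×₁ F₁ (T S) (handle S S' X)) ∘ ⟨ π₁ , st (T S) ⟩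
        handle-op : ∀ S S' X {op A B} (p : (op , A , B) ∈ˢ S) →
                    handle S S' X ∘ (id ×₁ aop S S' X p) ≈ eval ∘ (πop S S' X p ×₁ id)

    record EMHandlers : Set (o ⊔ ℓ ⊔ e) where
      field
        h    : ∀ (S S' : Sig) (X : Obj) → H S S' X ⇒ EM (T S) (F₀ (T S') X)
        h-op : ∀ S S' X {op A B} (p : (op , A , B) ∈ˢ S) →
               πop S S' X p ≈ pre (aop S S' X p) (F₀ (T S') X) ∘ eEM (T S) (F₀ (T S') X) ∘ h S S' X

    private
      module E {A B : Obj} = IsEquivalence (≈-equiv {A} {B})

    HandlersSetoid : Setoid (o ⊔ ℓ ⊔ e) (o ⊔ e)
    HandlersSetoid = record
      { Carrier = Handlers
      ; _≈_ = λ M N → ∀ S S' X → Handlers.handle M S S' X ≈ Handlers.handle N S S' X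
      ; isEquivalence = record
        { refl  = λ S S' X → E.refl
        ; sym   = λ p S S' X → E.sym (p S S' X)
        ; trans = λ p q S S' X → E.trans (p S S' X) (q S S' X)
        }
      }

    EMHandlersSetoid : Setoid (o ⊔ ℓ ⊔ e) (o ⊔ e)
    EMHandlersSetoid = record
      { Carrier = EMHandlers
      ; _≈_ = λ M N → ∀ S S' X → EMHandlers.h M S S' X ≈ EMHandlers.h N S S' X
      ; isEquivalence = record
        { refl  = λ S S' X → E.refl
        ; sym   = λ p S S' X → E.sym (p S S' X)
        ; trans = λ p q S S' X → E.trans (p S S' X) (q S S' X)
        }
      }

{-# OPTIONS --safe #-}
-- Currying identifies morphisms H × T Y → Y with morphisms H → (T Y ⇨ Y).
-- Under this transposition the unit and multiplication laws of a handler
-- become exactly the two equations cut out by the joint equaliser EM(T;Y),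
-- and its operation law becomes the defining equation of π_op.  So a
-- handler corresponds to the factorisation of its curried form through
-- e : EM(T;Y) → (T Y ⇨ Y), with inverse h ↦ uncurry (e ∘ h).
module Submission where

open import Defs
open import Level using (Level)
open import Data.Product using (_,_; proj₁; proj₂) renaming (_×_ to _×ᵗ_)
open import Function.Bundles using (Inverse)
open import Relation.Binary using (Setoid)
import Relation.Binary.Reasoning.Setoid as SetoidReasoning

module Transposition {o ℓ e : Level} (C : Category o ℓ e) (cc : CCCWithEqualisers C) (Op : Set) where
  open Category C
  open CCCWithEqualisers cc
  open Theory C cc Op
  open StrongMonad

  private
    variable
      A B W X Y Z : Obj

  hom-setoid : Obj → Obj → Setoid ℓ e
  hom-setoid A B = record { Carrier = A ⇒ B ; _≈_ = _≈_ ; isEquivalence = ≈-equiv }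

  module _ {A B : Obj} where
    open Setoid (hom-setoid A B) public
      using () renaming (refl to ≈-refl; sym to ≈-sym; trans to ≈-trans)

  module HomReasoning {A B : Obj} = SetoidReasoning (hom-setoid A B)

  ∘-congˡ : {f g : B ⇒ X} {h : A ⇒ B} → f ≈ g → f ∘ h ≈ g ∘ h
  ∘-congˡ p = ∘-resp-≈ p ≈-refl

  ∘-congʳ : {h : B ⇒ X} {f g : A ⇒ B} → f ≈ g → h ∘ f ≈ h ∘ g
  ∘-congʳ p = ∘-resp-≈ ≈-refl p

  ⟨⟩-cong : {f f' : X ⇒ A} {g g' : X ⇒ B} → f ≈ f' → g ≈ g' → ⟨ f , g ⟩ ≈ ⟨ f' , g' ⟩
  ⟨⟩-cong p q = ⟨⟩-unique (≈-trans project₁ (≈-sym p)) (≈-trans project₂ (≈-sym q))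

  ⟨⟩-injective : {f f' : X ⇒ A} {g g' : X ⇒ B} → ⟨ f , g ⟩ ≈ ⟨ f' , g' ⟩ → f ≈ f' ×ᵗ g ≈ g'
  ⟨⟩-injective p =
      ≈-trans (≈-sym project₁) (≈-trans (∘-congʳ p) project₁)
    , ≈-trans (≈-sym project₂) (≈-trans (∘-congʳ p) project₂)

  ⟨⟩∘ : {f : X ⇒ A} {g : X ⇒ B} {h : Y ⇒ X} → ⟨ f , g ⟩ ∘ h ≈ ⟨ f ∘ h , g ∘ h ⟩
  ⟨⟩∘ = ≈-sym (⟨⟩-unique (≈-trans (≈-sym assoc) (∘-congˡ project₁))
                         (≈-trans (≈-sym assoc) (∘-congˡ project₂)))

  ×₁∘⟨⟩ : {f : A ⇒ Y} {g : B ⇒ Z} {a : X ⇒ A} {b : X ⇒ B} →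
          (f ×₁ g) ∘ ⟨ a , b ⟩ ≈ ⟨ f ∘ a , g ∘ b ⟩
  ×₁∘⟨⟩ = ≈-trans ⟨⟩∘ (⟨⟩-cong (≈-trans assoc (∘-congʳ project₁)) (≈-trans assoc (∘-congʳ project₂)))

  ×₁∘×₁ : ∀ {A' B'} {f : A' ⇒ Y} {g : B' ⇒ Z} {f' : A ⇒ A'} {g' : B ⇒ B'} →
          (f ×₁ g) ∘ (f' ×₁ g') ≈ (f ∘ f') ×₁ (g ∘ g')
  ×₁∘×₁ = ≈-trans ×₁∘⟨⟩ (⟨⟩-cong (≈-sym assoc) (≈-sym assoc))

  first↔second : {f : A ⇒ Y} {g : B ⇒ Z} → (f ×₁ id) ∘ (id ×₁ g) ≈ (id ×₁ g) ∘ (f ×₁ id)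
  first↔second = ≈-trans ×₁∘×₁ (≈-trans (⟨⟩-cong (∘-congˡ (≈-trans identityʳ (≈-sym identityˡ)))
                                                 (∘-congˡ (≈-trans identityˡ (≈-sym identityʳ))))
                                        (≈-sym ×₁∘×₁))

  ×₁-cong : {f f' : A ⇒ Y} {g g' : B ⇒ Z} → f ≈ f' → g ≈ g' → f ×₁ g ≈ f' ×₁ g'
  ×₁-cong p q = ⟨⟩-cong (∘-congˡ p) (∘-congˡ q)

  uncurry : Z ⇒ (A ⇨ B) → Z × A ⇒ B
  uncurry k = eval ∘ (k ×₁ id)

  uncurry-cong : {k k' : Z ⇒ (A ⇨ B)} → k ≈ k' → uncurry k ≈ uncurry k'
  uncurry-cong p = ∘-congʳ (×₁-cong p ≈-refl)

  uncurry-unfold : {k : Z ⇒ (A ⇨ B)} → uncurry k ≈ eval ∘ ⟨ k ∘ π₁ , π₂ ⟩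
  uncurry-unfold = ∘-congʳ (⟨⟩-cong ≈-refl identityˡ)

  uncurry-curry : {f : Z × A ⇒ B} → uncurry (curry f) ≈ f
  uncurry-curry = ≈-trans uncurry-unfold β

  curry-uncurry : {k : Z ⇒ (A ⇨ B)} → curry (uncurry k) ≈ k
  curry-uncurry = ≈-sym (curry-unique (≈-sym uncurry-unfold))

  curry-cong : {f g : Z × A ⇒ B} → f ≈ g → curry f ≈ curry g
  curry-cong p = curry-unique (≈-trans β p)

  uncurry-injective : {k k' : Z ⇒ (A ⇨ B)} → uncurry k ≈ uncurry k' → k ≈ k'
  uncurry-injective p = ≈-trans (≈-sym curry-uncurry) (≈-trans (curry-cong p) curry-uncurry)

  transpose-≈ : {g g' : Z ⇒ (A ⇨ B)} {f f' : Z × A ⇒ B} →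
                uncurry g ≈ f → uncurry g' ≈ f' → g ≈ g' → f ≈ f'
  transpose-≈ p p' q = ≈-trans (≈-sym p) (≈-trans (uncurry-cong q) p')

  transpose-≈⁻ : {g g' : Z ⇒ (A ⇨ B)} {f f' : Z × A ⇒ B} →
                 uncurry g ≈ f → uncurry g' ≈ f' → f ≈ f' → g ≈ g'
  transpose-≈⁻ p p' q = uncurry-injective (≈-trans p (≈-trans q (≈-sym p')))

  uncurry-∘ : {k : Z ⇒ (A ⇨ B)} {g : W ⇒ Z} → uncurry (k ∘ g) ≈ uncurry k ∘ (g ×₁ id)
  uncurry-∘ = ≈-trans (∘-congʳ (≈-trans (⟨⟩-cong ≈-refl (∘-congˡ (≈-sym identityˡ))) (≈-sym ×₁∘×₁)))
                      (≈-sym assoc)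

  uncurry-pre : (u : A ⇒ B) (k : Z ⇒ (B ⇨ Y)) → uncurry (pre u Y ∘ k) ≈ uncurry k ∘ (id ×₁ u)
  uncurry-pre u k = begin
    uncurry (pre u _ ∘ k)                ≈⟨ uncurry-∘ ⟩
    uncurry (pre u _) ∘ (k ×₁ id)        ≈⟨ ∘-congˡ uncurry-curry ⟩
    (eval ∘ (id ×₁ u)) ∘ (k ×₁ id)       ≈⟨ assoc ⟩
    eval ∘ ((id ×₁ u) ∘ (k ×₁ id))       ≈⟨ ∘-congʳ (≈-sym first↔second) ⟩
    eval ∘ ((k ×₁ id) ∘ (id ×₁ u))       ≈⟨ ≈-sym assoc ⟩
    uncurry k ∘ (id ×₁ u)                ∎
    where open HomReasoning

  uncurry-iid : (t : Z ⇒ ⊤) → uncurry (iid Y ∘ t) ≈ π₂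
  uncurry-iid t = begin
    uncurry (iid _ ∘ t)          ≈⟨ uncurry-∘ ⟩
    uncurry (iid _) ∘ (t ×₁ id)  ≈⟨ ∘-congˡ uncurry-curry ⟩
    π₂ ∘ (t ×₁ id)               ≈⟨ project₂ ⟩
    id ∘ π₂                      ≈⟨ identityˡ ⟩
    π₂                           ∎
    where open HomReasoning

  uncurry-icomp : ∀ {W X Y Z} (g : Z ⇒ (Y ⇨ W)) (g' : Z ⇒ (X ⇨ Y)) →
                  uncurry (icomp ∘ ⟨ g , g' ⟩) ≈ uncurry g ∘ ⟨ π₁ , uncurry g' ⟩
  uncurry-icomp {W} {X} {Y} {Z} g g' = begin
    uncurry (icomp ∘ ⟨ g , g' ⟩)
      ≈⟨ uncurry-∘ ⟩
    uncurry icomp ∘ P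
      ≈⟨ ∘-congˡ uncurry-curry ⟩
    (eval ∘ ⟨ π₁ ∘ π₁ , eval ∘ ⟨ π₂ ∘ π₁ , π₂ ⟩ ⟩) ∘ P
      ≈⟨ ≈-trans assoc (∘-congʳ ⟨⟩∘) ⟩
    eval ∘ ⟨ (π₁ ∘ π₁) ∘ P , (eval ∘ ⟨ π₂ ∘ π₁ , π₂ ⟩) ∘ P ⟩
      ≈⟨ ∘-congʳ (⟨⟩-cong (π₁-through-P project₁) π₂-through-P) ⟩
    eval ∘ ⟨ g ∘ π₁ , id ∘ uncurry g' ⟩
      ≈⟨ ≈-trans (∘-congʳ (≈-sym ×₁∘⟨⟩)) (≈-sym assoc) ⟩
    uncurry g ∘ ⟨ π₁ , uncurry g' ⟩
      ∎
    where
    open HomReasoning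
    P : Z × X ⇒ ((Y ⇨ W) × (X ⇨ Y)) × X
    P = ⟨ g , g' ⟩ ×₁ id
    π₁-through-P : ∀ {V} {p : (Y ⇨ W) × (X ⇨ Y) ⇒ V} {c : Z ⇒ V} →
                 p ∘ ⟨ g , g' ⟩ ≈ c → (p ∘ π₁) ∘ P ≈ c ∘ π₁
    π₁-through-P q = ≈-trans assoc (≈-trans (∘-congʳ project₁) (≈-trans (≈-sym assoc) (∘-congˡ q)))
    π₂-through-P : (eval ∘ ⟨ π₂ ∘ π₁ , π₂ ⟩) ∘ P ≈ id ∘ uncurry g'
    π₂-through-P = ≈-trans assoc
      (≈-trans (∘-congʳ (≈-trans ⟨⟩∘ (⟨⟩-cong (π₁-through-P project₂) project₂))) (≈-sym identityˡ))

  uncurry-⌊⌋ : (T : StrongMonad) (k : Z ⇒ (X ⇨ Y)) → uncurry (⌊ T ⌋ ∘ k) ≈ F₁ T (uncurry k) ∘ st T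
  uncurry-⌊⌋ T k = begin
    uncurry (⌊ T ⌋ ∘ k)                         ≈⟨ uncurry-∘ ⟩
    uncurry ⌊ T ⌋ ∘ (k ×₁ id)                   ≈⟨ ∘-congˡ uncurry-curry ⟩
    (F₁ T eval ∘ st T) ∘ (k ×₁ id)              ≈⟨ assoc ⟩
    F₁ T eval ∘ (st T ∘ (k ×₁ id))              ≈⟨ ∘-congʳ (∘-congʳ (×₁-cong ≈-refl (≈-sym (F-id T)))) ⟩
    F₁ T eval ∘ (st T ∘ (k ×₁ F₁ T id))         ≈⟨ ∘-congʳ (st-nat T) ⟩
    F₁ T eval ∘ (F₁ T (k ×₁ id) ∘ st T)         ≈⟨ ≈-sym assoc ⟩
    (F₁ T eval ∘ F₁ T (k ×₁ id)) ∘ st T         ≈⟨ ∘-congˡ (≈-sym (F-∘ T)) ⟩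
    F₁ T (uncurry k) ∘ st T                     ∎
    where open HomReasoning

  -- A Z-indexed family of Eilenberg–Moore T-algebra structures on Y; the
  -- strength threads the parameter through the multiplication law.
  record IsParamEMAlgebra (T : StrongMonad) {Z Y : Obj} (f : Z × F₀ T Y ⇒ Y) : Set e where
    field
      unit-law : f ∘ (id ×₁ η T) ≈ π₂
      mult-law : f ∘ (id ×₁ μ T) ≈ f ∘ (id ×₁ F₁ T f) ∘ ⟨ π₁ , st T ⟩

  IsParamEMAlgebra-resp : (T : StrongMonad) {f f' : Z × F₀ T Y ⇒ Y} →
                          f ≈ f' → IsParamEMAlgebra T f → IsParamEMAlgebra T f'
  IsParamEMAlgebra-resp T {f} {f'} p alg = record
    { unit-law = ≈-trans (∘-congˡ (≈-sym p)) unit-law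
    ; mult-law = begin
        f' ∘ (id ×₁ μ T)                       ≈⟨ ∘-congˡ (≈-sym p) ⟩
        f ∘ (id ×₁ μ T)                        ≈⟨ mult-law ⟩
        f ∘ (id ×₁ F₁ T f) ∘ ⟨ π₁ , st T ⟩     ≈⟨ ∘-resp-≈ p (∘-congˡ (×₁-cong ≈-refl (F-resp T p))) ⟩
        f' ∘ (id ×₁ F₁ T f') ∘ ⟨ π₁ , st T ⟩   ∎
    }
    where
    open IsParamEMAlgebra alg
    open HomReasoning

  module _ (T : StrongMonad) {Z Y : Obj} (k : Z ⇒ (F₀ T Y ⇨ Y)) where

    private
      uncurry-unit-side : uncurry ((iid Y ∘ !) ∘ k) ≈ π₂
      uncurry-unit-side = ≈-trans (uncurry-cong assoc) (uncurry-iid (! ∘ k))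

      uncurry-mult-side : uncurry ((icomp ∘ ⟨ id , ⌊ T ⌋ ⟩) ∘ k)
                          ≈ uncurry k ∘ (id ×₁ F₁ T (uncurry k)) ∘ ⟨ π₁ , st T ⟩
      uncurry-mult-side = begin
        uncurry ((icomp ∘ ⟨ id , ⌊ T ⌋ ⟩) ∘ k)
          ≈⟨ uncurry-cong (≈-trans assoc (∘-congʳ (≈-trans ⟨⟩∘ (⟨⟩-cong identityˡ ≈-refl)))) ⟩
        uncurry (icomp ∘ ⟨ k , ⌊ T ⌋ ∘ k ⟩)
          ≈⟨ uncurry-icomp k (⌊ T ⌋ ∘ k) ⟩
        uncurry k ∘ ⟨ π₁ , uncurry (⌊ T ⌋ ∘ k) ⟩
          ≈⟨ ∘-congʳ (⟨⟩-cong (≈-sym identityˡ) (uncurry-⌊⌋ T k)) ⟩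
        uncurry k ∘ ⟨ id ∘ π₁ , F₁ T (uncurry k) ∘ st T ⟩
          ≈⟨ ∘-congʳ (≈-sym ×₁∘⟨⟩) ⟩
        uncurry k ∘ (id ×₁ F₁ T (uncurry k)) ∘ ⟨ π₁ , st T ⟩
          ∎
        where open HomReasoning

    EM-equalises⇒isParamEMAlgebra : EM-left T Y ∘ k ≈ EM-right T Y ∘ k →
                                    IsParamEMAlgebra T (uncurry k)
    EM-equalises⇒isParamEMAlgebra eq = record
      { unit-law = transpose-≈ (uncurry-pre (η T) k) uncurry-unit-side (proj₁ equations)
      ; mult-law = transpose-≈ (uncurry-pre (μ T) k) uncurry-mult-side (proj₂ equations)
      }
      where
      equations : pre (η T) Y ∘ k ≈ (iid Y ∘ !) ∘ k ×ᵗ pre (μ T) Y ∘ k ≈ (icomp ∘ ⟨ id , ⌊ T ⌋ ⟩) ∘ k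
      equations = ⟨⟩-injective (≈-trans (≈-sym ⟨⟩∘) (≈-trans eq ⟨⟩∘))

    isParamEMAlgebra⇒EM-equalises : IsParamEMAlgebra T (uncurry k) →
                                    EM-left T Y ∘ k ≈ EM-right T Y ∘ k
    isParamEMAlgebra⇒EM-equalises alg =
      ≈-trans ⟨⟩∘ (≈-trans (⟨⟩-cong unit-equation mult-equation) (≈-sym ⟨⟩∘))
      where
      open IsParamEMAlgebra alg
      unit-equation : pre (η T) Y ∘ k ≈ (iid Y ∘ !) ∘ k
      unit-equation = transpose-≈⁻ (uncurry-pre (η T) k) uncurry-unit-side unit-law
      mult-equation : pre (μ T) Y ∘ k ≈ (icomp ∘ ⟨ id , ⌊ T ⌋ ⟩) ∘ k
      mult-equation = transpose-≈⁻ (uncurry-pre (μ T) k) uncurry-mult-side mult-law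

  module _ (T : StrongMonad) {Z Y : Obj} where

    curryEM : (f : Z × F₀ T Y ⇒ Y) → IsParamEMAlgebra T f → Z ⇒ EM T Y
    curryEM f alg = factor (curry f)
      (isParamEMAlgebra⇒EM-equalises T (curry f) (IsParamEMAlgebra-resp T (≈-sym uncurry-curry) alg))

    uncurryEM : Z ⇒ EM T Y → Z × F₀ T Y ⇒ Y
    uncurryEM g = uncurry (eEM T Y ∘ g)

    uncurryEM-isParamEMAlgebra : (g : Z ⇒ EM T Y) → IsParamEMAlgebra T (uncurryEM g)
    uncurryEM-isParamEMAlgebra g = EM-equalises⇒isParamEMAlgebra T (eEM T Y ∘ g)
      (≈-trans (≈-sym assoc) (≈-trans (∘-congˡ equality) assoc))

    uncurryEM-curryEM : {f : Z × F₀ T Y ⇒ Y} (alg : IsParamEMAlgebra T f) → uncurryEM (curryEM f alg) ≈ f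
    uncurryEM-curryEM alg = ≈-trans (uncurry-cong factor-commute) uncurry-curry

    curryEM-uncurryEM : (g : Z ⇒ EM T Y) (alg : IsParamEMAlgebra T (uncurryEM g)) →
                        curryEM (uncurryEM g) alg ≈ g
    curryEM-uncurryEM g alg = ≈-sym (factor-unique g (≈-sym curry-uncurry))

    curryEM-cong : {f f' : Z × F₀ T Y ⇒ Y} (alg : IsParamEMAlgebra T f) (alg' : IsParamEMAlgebra T f') →
                   f ≈ f' → curryEM f alg ≈ curryEM f' alg'
    curryEM-cong alg alg' p = factor-unique _ (≈-trans factor-commute (curry-cong p))

    uncurryEM-cong : {g g' : Z ⇒ EM T Y} → g ≈ g' → uncurryEM g ≈ uncurryEM g'
    uncurryEM-cong p = uncurry-cong (∘-congʳ p)

module Correspondence {o ℓ e : Level} (C : Category o ℓ e) (cc : CCCWithEqualisers C) (Op : Set) where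
  open Category C
  open CCCWithEqualisers cc
  open Theory C cc Op
  open Transposition C cc Op
  open StrongMonad using (F₀)

  module _ (T : Sig → StrongMonad) (ops : Interp T) where

    handle-isParamEMAlgebra : (M : Handlers T ops) (S S' : Sig) (X : Obj) →
                              IsParamEMAlgebra (T S) (Handlers.handle M S S' X)
    handle-isParamEMAlgebra M S S' X = record { unit-law = handle-η S S' X ; mult-law = handle-μ S S' X }
      where open Handlers M

    toEMHandlers : Handlers T ops → EMHandlers T ops
    toEMHandlers M = record { h = h ; h-op = h-op }
      where
      open Handlers M
      h : ∀ S S' X → H T ops S S' X ⇒ EM (T S) (F₀ (T S') X)
      h S S' X = curryEM (T S) (handle S S' X) (handle-isParamEMAlgebra M S S' X)
      h-op : ∀ S S' X {op A B} (p : (op , A , B) ∈ˢ S) →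
             πop T ops S S' X p
               ≈ pre (aop T ops S S' X p) (F₀ (T S') X) ∘ eEM (T S) (F₀ (T S') X) ∘ h S S' X
      h-op S S' X {A = A} {B} p = uncurry-injective (begin
        uncurry (πop T ops S S' X p)                ≈⟨ ≈-sym (handle-op S S' X p) ⟩
        handle S S' X ∘ (id ×₁ a)                   ≈⟨ ∘-congˡ (≈-sym (uncurryEM-curryEM (T S) handle-alg)) ⟩
        uncurryEM (T S) (h S S' X) ∘ (id ×₁ a)      ≈⟨ ≈-sym (uncurry-pre a (eEM (T S) Y ∘ h S S' X)) ⟩
        uncurry (pre a Y ∘ eEM (T S) Y ∘ h S S' X)  ∎)
        where
        open HomReasoning
        Y : Obj
        Y = F₀ (T S') X
        a : A × (B ⇒[ T S' ] X) ⇒ F₀ (T S) Y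
        a = aop T ops S S' X p
        handle-alg : IsParamEMAlgebra (T S) (handle S S' X)
        handle-alg = handle-isParamEMAlgebra M S S' X

    fromEMHandlers : EMHandlers T ops → Handlers T ops
    fromEMHandlers N = record
      { handle    = handle
      ; handle-η  = λ S S' X → IsParamEMAlgebra.unit-law (uncurryEM-isParamEMAlgebra (T S) (h S S' X))
      ; handle-μ  = λ S S' X → IsParamEMAlgebra.mult-law (uncurryEM-isParamEMAlgebra (T S) (h S S' X))
      ; handle-op = λ S S' X p → ≈-trans (≈-sym (uncurry-pre _ _)) (uncurry-cong (≈-sym (h-op S S' X p)))
      }
      where
      open EMHandlers N
      handle : ∀ S S' X → H T ops S S' X × F₀ (T S) (F₀ (T S') X) ⇒ F₀ (T S') X
      handle S S' X = uncurryEM (T S) (h S S' X)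

    handlers↔EMHandlers : Inverse (HandlersSetoid T ops) (EMHandlersSetoid T ops)
    handlers↔EMHandlers = record
      { to        = toEMHandlers
      ; from      = fromEMHandlers
      ; to-cong   = λ {M M'} → to-cong {M} {M'}
      ; from-cong = λ {N N'} → from-cong {N} {N'}
      ; inverse   =
          (λ {N} {M} p S S' X →
             ≈-trans (to-cong {M} {fromEMHandlers N} p S S' X) (toEMHandlers-fromEMHandlers N S S' X))
        , (λ {M} {N} p S S' X →
             ≈-trans (from-cong {N} {toEMHandlers M} p S S' X) (fromEMHandlers-toEMHandlers M S S' X))
      }
      where
      open Setoid (HandlersSetoid T ops) using () renaming (_≈_ to _≈ᴴ_)
      open Setoid (EMHandlersSetoid T ops) using () renaming (_≈_ to _≈ᴱ_)
      to-cong : ∀ {M M'} → M ≈ᴴ M' → toEMHandlers M ≈ᴱ toEMHandlers M'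
      to-cong {M} {M'} p S S' X = curryEM-cong (T S)
        (handle-isParamEMAlgebra M S S' X) (handle-isParamEMAlgebra M' S S' X) (p S S' X)
      from-cong : ∀ {N N'} → N ≈ᴱ N' → fromEMHandlers N ≈ᴴ fromEMHandlers N'
      from-cong p S S' X = uncurryEM-cong (T S) (p S S' X)
      toEMHandlers-fromEMHandlers : ∀ N → toEMHandlers (fromEMHandlers N) ≈ᴱ N
      toEMHandlers-fromEMHandlers N S S' X =
        curryEM-uncurryEM (T S) (h S S' X) (uncurryEM-isParamEMAlgebra (T S) (h S S' X))
        where open EMHandlers N
      fromEMHandlers-toEMHandlers : ∀ M → fromEMHandlers (toEMHandlers M) ≈ᴴ M
      fromEMHandlers-toEMHandlers M S S' X = uncurryEM-curryEM (T S) (handle-isParamEMAlgebra M S S' X)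

proposition4p11 : ∀ {o ℓ e : Level} (C : Category o ℓ e) (cc : CCCWithEqualisers C) (Op : Set) →
    let open Theory C cc Op in
      (T : Sig → StrongMonad) (ops : Interp T) →
      Inverse (HandlersSetoid T ops) (EMHandlersSetoid T ops)
proposition4p11 C cc Op = Correspondence.handlers↔EMHandlers C cc Op
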